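{- Let $n\ge1$ and let $(A_1,\dots,A_n)$ be a sequence of words. Then there exists exactly one $n$-bounded index collection that is maximal for $(A_1,\dots,A_n)$, and it is $(s_1,\dots,s_m)$ where $m,s_0,s_1,\dots$ are determined by: $s_0=0$; if $s_k\ne n$ then $s_{k+1}$ is the least $f$ with $s_k<f\le n$ such that $A_l\precsim A_f$ for all $l$ with $s_k<l\le n$; if $s_k=n$ then $s_{k+1}=n$; and $m=\min\{f\ge1\mid s_f=n\}$.
   Context: A word is a finite string over $\mathbb{N}$; $\Lambda$ is the empty word. $\mathsf{S}_k$ is the set of words all of whose symbols are $\ge k$. A relation $\precsim$ on words is defined by induction on (maximal symbol minus minimal symbol) of $AB$: $\Lambda\precsim\Lambda$; if $AB$ is nonempty with minimal symbol $n$, write uniquely $A=A_1n\dots nA_k$, $B=B_1n\dots nB_l$ with $k,l\ge1$ and all $A_i,B_j\in\mathsf{S}_{n+1}$; let $(C_i)$, $(D_j)$ be lexicographically maximal subsequences of $(A_1,\dots,A_k)$, $(B_1,\dots,B_l)$; then $A\precsim B$ iff $(C_i)$ is lexicographically not greater than $(D_j)$. Here $(X_1,\dots,X_p)$ is lexicographically not greater than $(Y_1,\dots,Y_q)$ iff either $p\le q$ and $X_i\sim Y_i$ for all $i\le p$, or there is $s<\min(p,q)$ with $X_i\sim Y_i$ for $i\le s$ and $X_{s+1}\precsim Y_{s+1}$; $A\sim B$ iff $A\precsim B$ and $B\precsim A$. $\precsim$ is a linear preorder on words. An index collection is a strictly increasing finite sequence of positive integers; it is $n$-bounded if all its entries are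 $\le n$. An $n$-bounded index collection $(t_1,\dots,t_r)$ corresponds to the subsequence $(A_{t_1},\dots,A_{t_r})$ of $(A_1,\dots,A_n)$; it is maximal for $(A_1,\dots,A_n)$ if this subsequence is lexicographically not less than every subsequence of $(A_1,\dots,A_n)$. -}

module Defs where

open import Data.Nat using (ℕ; zero; suc; _≤_; _<_; _⊓_; _⊔_; _∸_; _≡ᵇ_)
open import Data.Bool using (Bool; true; false; _∧_; _∨_; not; if_then_else_)
open import Data.List using (List; []; _∷_; _++_; foldr; map; upTo)
open import Data.List.Relation.Unary.All using (All)
open import Data.List.Relation.Unary.Linked using (Linked)
open import Data.Product using (_×_; Σ-syntax)
open import Relation.Binary.PropositionalEquality using (_≡_; _≢_)

allB : {X : Set} → (X → Bool) → List X → Bool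
allB p []       = true
allB p (x ∷ xs) = p x ∧ allB p xs

Word : Set
Word = List ℕ

-- maximal symbol (0 for the empty word; only used for nonempty words)
maxSym : Word → ℕ
maxSym = foldr _⊔_ 0

-- minimal symbol (0 for the empty word; only used for nonempty words)
minSym : Word → ℕ
minSym []       = 0
minSym (x ∷ xs) = foldr _⊓_ x xs

-- Unique decomposition A = A₁ n A₂ n … n A_k (k ≥ 1), returning (A₁,…,A_k).
consHead : ℕ → List Word → List Word
consHead x []       = (x ∷ []) ∷ []
consHead x (p ∷ ps) = (x ∷ p) ∷ ps

splitAt : ℕ → Word → List Word
splitAt n []       = [] ∷ []
splitAt n (x ∷ xs) = if x ≡ᵇ n then [] ∷ splitAt n xs else consHead x (splitAt n xs)

subseqs : {X : Set} → List X → List (List X)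
subseqs []       = [] ∷ []
subseqs (x ∷ xs) = map (x ∷_) (subseqs xs) ++ subseqs xs

-- Lexicographic "not greater than" for a preorder given as a Boolean relation le:
-- (X₁..X_p) ≤ (Y₁..Y_q) iff either p ≤ q and X_i ~ Y_i for i ≤ p, or for some s < min(p,q)
-- X_i ~ Y_i for i ≤ s and X_{s+1} is strictly below Y_{s+1}.
lexLeq : {X : Set} → (X → X → Bool) → List X → List X → Bool
lexLeq le []       ys       = true
lexLeq le (x ∷ xs) []       = false
lexLeq le (x ∷ xs) (y ∷ ys) =
  if le x y ∧ le y x then lexLeq le xs ys else le x y

isMaxSub : {X : Set} → (X → X → Bool) → List X → List X → Bool
isMaxSub le P C = allB (λ T → lexLeq le T C) (subseqs P)

-- The relation ≾ computed with fuel; fuel suc f suffices whenever (max − min) of AB is ≤ f.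
leqF : ℕ → Word → Word → Bool
leqF zero    A B = true
leqF (suc f) A B with A ++ B
... | []     = true
... | x ∷ xs =
  let n  = foldr _⊓_ x xs
      PA = splitAt n A
      PB = splitAt n B
      le = leqF f
  in allB (λ C → not (isMaxSub le PA C) ∨
                allB (λ D → not (isMaxSub le PB D) ∨ lexLeq le C D) (subseqs PB))
         (subseqs PA)

leq : Word → Word → Bool
leq A B = leqF (suc (maxSym (A ++ B) ∸ minSym (A ++ B))) A B

infix 4 _≾_
_≾_ : Word → Word → Set
A ≾ B = leq A B ≡ true

infix 4 _≤lex_
_≤lex_ : List Word → List Word → Set
xs ≤lex ys = lexLeq leq xs ys ≡ true

IndexCollection : ℕ → List ℕ → Set
IndexCollection n ts = Linked _<_ ts × All (λ t → 1 ≤ t × t ≤ n) ts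

-- Sequence (A₁,…,A_n) is given as A : ℕ → Word (only A 1, …, A n are used).
IsMaximal : ℕ → (ℕ → Word) → List ℕ → Set
IsMaximal n A ts =
  IndexCollection n ts ×
  (∀ us → IndexCollection n us → map A us ≤lex map A ts)

Good : ℕ → (ℕ → Word) → ℕ → ℕ → Set
Good n A a f = a < f × f ≤ n × (∀ l → a < l → l ≤ n → A l ≾ A f)

IsLeastGood : ℕ → (ℕ → Word) → ℕ → ℕ → Set
IsLeastGood n A a f = Good n A a f × (∀ g → Good n A a g → f ≤ g)

SeqSpec : ℕ → (ℕ → Word) → (ℕ → ℕ) → Set
SeqSpec n A s =
  s 0 ≡ 0 ×
  (∀ k → (s k ≢ n → IsLeastGood n A (s k) (s (suc k))) × (s k ≡ n → s (suc k) ≡ n))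

IsMinHit : ℕ → (ℕ → ℕ) → ℕ → Set
IsMinHit n s m = 1 ≤ m × s m ≡ n × (∀ f → 1 ≤ f → f < m → s f ≢ n)

firstTerms : (ℕ → ℕ) → ℕ → List ℕ
firstTerms s m = map (λ i → s (suc i)) (upTo m)

-- The relation ≾ is a total preorder. leqF splits a pair of words at its minimal symbol, which
-- varies from pair to pair; splitting instead at a fixed symbol k (leqAt) gives the same answer on
-- words with symbols in [k, k + f), and leqAt is a total preorder by induction on f, because each
-- level is the lexicographic comparison of maximal subsequences under the total preorder below it.
--
-- The maximal collection above a is built greedily: the least index g whose word dominates every
-- A_l with a < l ≤ n, followed by the maximal collection above g. For uniqueness, a competitor that
-- is not smaller must start at some u with A_u ~ A_g, so g ≤ u. If g < u, then A_u dominates the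
-- rest of the competitor, which is therefore strictly below u followed by that rest; but the
-- latter lies above g, so it is at most the greedy tail after g.
module Submission where

open import Data.Bool using (Bool; true; false; _∧_; _∨_; not)
open import Data.Bool.Properties using (∧-conicalˡ; ∧-conicalʳ; ¬-not)
open import Data.Empty using (⊥-elim)
open import Data.List using (List; []; _∷_; _++_; foldr; map; applyUpTo)
open import Data.List.Membership.Propositional using (_∈_)
open import Data.List.Properties
  using (++-conicalˡ; ++-conicalʳ; map-upTo; foldr-preservesᵇ; foldr-preservesʳ; foldr-forcesᵇ)
open import Data.List.Relation.Unary.All as All using (All; []; _∷_)
open import Data.List.Relation.Unary.All.Properties using (++⁺; ++⁻ˡ; ++⁻ʳ; map⁺)
open import Data.List.Relation.Unary.Any using (here; there)
open import Data.List.Relation.Unary.Linked as Linked using (Linked; [-]; _∷_)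
open import Data.List.Relation.Unary.Linked.Properties using (Linked⇒All)
open import Data.Nat using (ℕ; zero; suc; _≤_; _<_; _+_; _∸_; _⊓_; _≡ᵇ_; _<?_; _≟_; z≤n; s≤s; z<s)
open import Data.Nat.Properties
open import Data.Product using (_×_; _,_; proj₁; proj₂; Σ-syntax)
open import Data.Sum as Sum using (_⊎_; inj₁; inj₂)
open import Function using (_∘_; id)
open import Relation.Binary.PropositionalEquality
  using (_≡_; _≢_; refl; sym; trans; cong; cong₂; subst)
open import Relation.Nullary using (¬_; yes; no; contradiction)
open import Relation.Unary using (Decidable)

open import Defs

∧-intro : ∀ {a b} → a ≡ true → b ≡ true → a ∧ b ≡ true
∧-intro refl refl = refl

not-∨-elim : ∀ {a b} → not a ∨ b ≡ true → a ≡ true → b ≡ true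
not-∨-elim h refl = h

not-∨-intro : ∀ {a b} → (a ≡ true → b ≡ true) → not a ∨ b ≡ true
not-∨-intro {true}  f = f refl
not-∨-intro {false} f = refl

≡true⇒≢false : ∀ {b} → b ≡ true → ¬ b ≡ false
≡true⇒≢false refl ()

allB⇒All : ∀ {X : Set} {p : X → Bool} xs → allB p xs ≡ true → All (λ x → p x ≡ true) xs
allB⇒All []       h = []
allB⇒All (x ∷ xs) h = ∧-conicalˡ _ _ h ∷ allB⇒All xs (∧-conicalʳ _ _ h)

All⇒allB : ∀ {X : Set} {p : X → Bool} {xs} → All (λ x → p x ≡ true) xs → allB p xs ≡ true
All⇒allB []       = refl
All⇒allB (h ∷ hs) = ∧-intro h (All⇒allB hs)

allB-cong : ∀ {X : Set} {p q : X → Bool} {xs} → All (λ x → p x ≡ q x) xs → allB p xs ≡ allB q xs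
allB-cong []       = refl
allB-cong (h ∷ hs) = cong₂ _∧_ h (allB-cong hs)

subseqs-nonempty : ∀ {X : Set} (P : List X) → Σ[ c ∈ List X ] Σ[ L ∈ List (List X) ] subseqs P ≡ c ∷ L
subseqs-nonempty []       = [] , [] , refl
subseqs-nonempty (x ∷ xs) with subseqs xs | subseqs-nonempty xs
... | _ | c , L , refl = x ∷ c , _ , refl

maxSubLeq : {X : Set} → (X → X → Bool) → List X → List X → Bool
maxSubLeq le P Q = allB (λ C → not (isMaxSub le P C) ∨
                     allB (λ D → not (isMaxSub le Q D) ∨ lexLeq le C D) (subseqs Q))
                   (subseqs P)

TotalPreorderᵇ : {X : Set} → (X → X → Bool) → Set
TotalPreorderᵇ le = (∀ x y → le x y ≡ true ⊎ le y x ≡ true) ×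
                    (∀ {x y z} → le x y ≡ true → le y z ≡ true → le x z ≡ true)

module Lexicographic {X : Set} {le : X → X → Bool} (tp : TotalPreorderᵇ le) where

  infix 4 _≼_ _≤ₗ_

  _≼_ : X → X → Set
  x ≼ y = le x y ≡ true

  _≤ₗ_ : List X → List X → Set
  xs ≤ₗ ys = lexLeq le xs ys ≡ true

  ≼-total : ∀ x y → x ≼ y ⊎ y ≼ x
  ≼-total = proj₁ tp

  ≼-trans : ∀ {x y z} → x ≼ y → y ≼ z → x ≼ z
  ≼-trans = proj₂ tp

  ≼-refl : ∀ x → x ≼ x
  ≼-refl x with ≼-total x x
  ... | inj₁ h = h
  ... | inj₂ h = h

  ≼-or-⋠ : ∀ x y → x ≼ y ⊎ le x y ≡ false
  ≼-or-⋠ x y with le x y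
  ... | true  = inj₁ refl
  ... | false = inj₂ refl

  ≼-flip : ∀ {x y} → le x y ≡ false → y ≼ x
  ≼-flip {x} {y} x⋠y with ≼-total x y
  ... | inj₁ x≼y = ⊥-elim (≡true⇒≢false x≼y x⋠y)
  ... | inj₂ y≼x = y≼x

  ≼-⋠-trans : ∀ {x y z} → x ≼ y → le z y ≡ false → le z x ≡ false
  ≼-⋠-trans x≼y z⋠y = ¬-not λ z≼x → ≡true⇒≢false (≼-trans z≼x x≼y) z⋠y

  ⋠-≼-trans : ∀ {x y z} → le y x ≡ false → y ≼ z → le z x ≡ false
  ⋠-≼-trans y⋠x y≼z = ¬-not λ z≼x → ≡true⇒≢false (≼-trans y≼z z≼x) y⋠x

  ∷-≤ₗ-inv : ∀ {x y xs ys} → (x ∷ xs) ≤ₗ (y ∷ ys) →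
             (x ≼ y × y ≼ x × xs ≤ₗ ys) ⊎ (x ≼ y × le y x ≡ false)
  ∷-≤ₗ-inv {x} {y} h with le x y | le y x
  ... | true  | true  = inj₁ (refl , refl , h)
  ... | true  | false = inj₂ (refl , refl)
  ... | false | _     = ⊥-elim (≡true⇒≢false h refl)

  ∷-≤ₗ-~ : ∀ {x y xs ys} → x ≼ y → y ≼ x → xs ≤ₗ ys → (x ∷ xs) ≤ₗ (y ∷ ys)
  ∷-≤ₗ-~ x≼y y≼x h rewrite x≼y | y≼x = h

  ∷-≤ₗ-< : ∀ {x y xs ys} → x ≼ y → le y x ≡ false → (x ∷ xs) ≤ₗ (y ∷ ys)
  ∷-≤ₗ-< x≼y y⋠x rewrite x≼y | y⋠x = refl

  ≤ₗ-total : ∀ xs ys → xs ≤ₗ ys ⊎ ys ≤ₗ xs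
  ≤ₗ-total []       ys       = inj₁ refl
  ≤ₗ-total (x ∷ xs) []       = inj₂ refl
  ≤ₗ-total (x ∷ xs) (y ∷ ys) with le x y in x≼y | le y x in y≼x
  ... | true  | true  = ≤ₗ-total xs ys
  ... | true  | false = inj₁ refl
  ... | false | true  = inj₂ refl
  ... | false | false = ⊥-elim (≡true⇒≢false (≼-flip x≼y) y≼x)

  ≤ₗ-trans : ∀ {xs ys zs} → xs ≤ₗ ys → ys ≤ₗ zs → xs ≤ₗ zs
  ≤ₗ-trans {[]}     _  _ = refl
  ≤ₗ-trans {_ ∷ _}  {[]} ()
  ≤ₗ-trans {_ ∷ _}  {_ ∷ _} {[]} _ ()
  ≤ₗ-trans {x ∷ xs} {y ∷ ys} {z ∷ zs} h₁ h₂
    with ∷-≤ₗ-inv {xs = xs} {ys} h₁ | ∷-≤ₗ-inv {xs = ys} {zs} h₂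
  ... | inj₁ (x≼y , y≼x , t₁) | inj₁ (y≼z , z≼y , t₂) =
    ∷-≤ₗ-~ {xs = xs} {zs} (≼-trans x≼y y≼z) (≼-trans z≼y y≼x) (≤ₗ-trans {xs} {ys} t₁ t₂)
  ... | inj₁ (x≼y , _ , _) | inj₂ (y≼z , z⋠y) =
    ∷-≤ₗ-< {xs = xs} {zs} (≼-trans x≼y y≼z) (≼-⋠-trans x≼y z⋠y)
  ... | inj₂ (x≼y , y⋠x)   | inj₁ (y≼z , _ , _) =
    ∷-≤ₗ-< {xs = xs} {zs} (≼-trans x≼y y≼z) (⋠-≼-trans y⋠x y≼z)
  ... | inj₂ (x≼y , _)     | inj₂ (y≼z , z⋠y) =
    ∷-≤ₗ-< {xs = xs} {zs} (≼-trans x≼y y≼z) (≼-⋠-trans x≼y z⋠y)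

  ≤ₗ-refl : ∀ xs → xs ≤ₗ xs
  ≤ₗ-refl xs with ≤ₗ-total xs xs
  ... | inj₁ h = h
  ... | inj₂ h = h

  ∷-dominating-≰ₗ : ∀ {x ys} → All (_≼ x) ys → ¬ (x ∷ ys) ≤ₗ ys
  ∷-dominating-≰ₗ []                    ()
  ∷-dominating-≰ₗ {x} {y ∷ ys} (y≼x ∷ ys≼x) h with ∷-≤ₗ-inv {xs = y ∷ ys} {ys} h
  ... | inj₁ (x≼y , _ , t) = ∷-dominating-≰ₗ (All.map (λ z≼x → ≼-trans z≼x x≼y) ys≼x) t
  ... | inj₂ (_ , y⋠x)     = ≡true⇒≢false y≼x y⋠x

  lexMaximum : ∀ c L → Σ[ M ∈ List X ] M ∈ c ∷ L × All (_≤ₗ M) (c ∷ L)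
  lexMaximum c [] = c , here refl , ≤ₗ-refl c ∷ []
  lexMaximum c (d ∷ L) with lexMaximum d L
  ... | M , M∈ , ≤M with ≤ₗ-total c M
  ...   | inj₁ c≤M = M , there M∈ , c≤M ∷ ≤M
  ...   | inj₂ M≤c = c , here refl , ≤ₗ-refl c ∷ All.map (λ {T} T≤M → ≤ₗ-trans {T} T≤M M≤c) ≤M

  maxSubseq : (P : List X) → Σ[ M ∈ List X ] M ∈ subseqs P × isMaxSub le P M ≡ true
  maxSubseq P with subseqs P | subseqs-nonempty P
  ... | _ | c , L , refl with lexMaximum c L
  ...   | M , M∈ , ≤M = M , M∈ , All⇒allB ≤M

  maxSubseqOf : List X → List X
  maxSubseqOf P = proj₁ (maxSubseq P)

  maxSubLeq⇒≤ₗ : ∀ P Q → maxSubLeq le P Q ≡ true → maxSubseqOf P ≤ₗ maxSubseqOf Q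
  maxSubLeq⇒≤ₗ P Q h with maxSubseq P | maxSubseq Q
  ... | M , M∈ , M-max | N , N∈ , N-max =
    not-∨-elim (All.lookup (allB⇒All (subseqs Q) M≤maximalsOfQ) N∈) N-max
    where
    M≤maximalsOfQ = not-∨-elim (All.lookup (allB⇒All (subseqs P) h) M∈) M-max

  ≤ₗ⇒maxSubLeq : ∀ P Q → maxSubseqOf P ≤ₗ maxSubseqOf Q → maxSubLeq le P Q ≡ true
  ≤ₗ⇒maxSubLeq P Q h with maxSubseq P | maxSubseq Q
  ... | M , M∈ , M-max | N , N∈ , N-max =
    All⇒allB {xs = subseqs P} (All.tabulate λ {C} C∈ → not-∨-intro {isMaxSub le P C} λ C-max →
      All⇒allB {xs = subseqs Q} (All.tabulate λ {D} D∈ → not-∨-intro {isMaxSub le Q D} λ D-max →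
        ≤ₗ-trans {C} (All.lookup (allB⇒All (subseqs P) M-max) C∈)
          (≤ₗ-trans {M} h (All.lookup (allB⇒All (subseqs Q) D-max) N∈))))

  maxSubLeq-totalPreorder : TotalPreorderᵇ (maxSubLeq le)
  maxSubLeq-totalPreorder = total , λ {P} {Q} {R} h₁ h₂ →
    ≤ₗ⇒maxSubLeq P R (≤ₗ-trans {maxSubseqOf P} (maxSubLeq⇒≤ₗ P Q h₁) (maxSubLeq⇒≤ₗ Q R h₂))
    where
    total : ∀ P Q → maxSubLeq le P Q ≡ true ⊎ maxSubLeq le Q P ≡ true
    total P Q with ≤ₗ-total (maxSubseqOf P) (maxSubseqOf Q)
    ... | inj₁ h = inj₁ (≤ₗ⇒maxSubLeq P Q h)
    ... | inj₂ h = inj₂ (≤ₗ⇒maxSubLeq Q P h)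

  maxSubLeq-[-] : ∀ x y → maxSubLeq le (x ∷ []) (y ∷ []) ≡ le x y
  maxSubLeq-[-] x y rewrite ≼-refl x | ≼-refl y with le x y | le y x
  ... | true  | true  = refl
  ... | true  | false = refl
  ... | false | true  = refl
  ... | false | false = refl

module Agreement {X : Set} (S : X → Set) {le le′ : X → X → Bool}
                 (agree : ∀ {x y} → S x → S y → le x y ≡ le′ x y) where

  lexLeq-cong : ∀ {xs ys} → All S xs → All S ys → lexLeq le xs ys ≡ lexLeq le′ xs ys
  lexLeq-cong []         _          = refl
  lexLeq-cong (_ ∷ _)    []         = refl
  lexLeq-cong (sx ∷ sxs) (sy ∷ sys) rewrite agree sx sy | agree sy sx | lexLeq-cong sxs sys = refl

  subseqs-All : ∀ {P} → All S P → All (All S) (subseqs P)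
  subseqs-All []         = [] ∷ []
  subseqs-All (sx ∷ sxs) = ++⁺ (map⁺ (All.map (sx ∷_) (subseqs-All sxs))) (subseqs-All sxs)

  isMaxSub-cong : ∀ {P C} → All S P → All S C → isMaxSub le P C ≡ isMaxSub le′ P C
  isMaxSub-cong sP sC = allB-cong (All.map (λ sT → lexLeq-cong sT sC) (subseqs-All sP))

  maxSubLeq-cong : ∀ {P Q} → All S P → All S Q → maxSubLeq le P Q ≡ maxSubLeq le′ P Q
  maxSubLeq-cong sP sQ = allB-cong (All.map (λ sC →
    cong₂ _∨_ (cong not (isMaxSub-cong sP sC))
      (allB-cong (All.map (λ sD → cong₂ _∨_ (cong not (isMaxSub-cong sQ sD)) (lexLeq-cong sC sD))
        (subseqs-All sQ))))
    (subseqs-All sP))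

TotalPreorderᵇ-on : ∀ {X Y : Set} {le : X → X → Bool} (g : Y → X) →
                    TotalPreorderᵇ le → TotalPreorderᵇ (λ a b → le (g a) (g b))
TotalPreorderᵇ-on g (total , trans′) = (λ a b → total (g a) (g b)) , trans′

≡ᵇ-refl : ∀ x → (x ≡ᵇ x) ≡ true
≡ᵇ-refl zero    = refl
≡ᵇ-refl (suc x) = ≡ᵇ-refl x

>⇒≡ᵇ-false : ∀ {k x} → k < x → (x ≡ᵇ k) ≡ false
>⇒≡ᵇ-false {zero}  {suc x} _         = refl
>⇒≡ᵇ-false {suc k} {suc x} (s≤s k<x) = >⇒≡ᵇ-false k<x

Bounded : ℕ → ℕ → Word → Set
Bounded lo hi = All (λ x → lo ≤ x × x < hi)

Bounded-empty : ∀ {lo hi w} → hi ≤ lo → Bounded lo hi w → w ≡ []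
Bounded-empty hi≤lo []                  = refl
Bounded-empty hi≤lo ((lo≤x , x<hi) ∷ _) = ⊥-elim (<-irrefl refl (<-≤-trans x<hi (≤-trans hi≤lo lo≤x)))

Bounded-raise : ∀ {lo lo′ hi w} → All (lo′ ≤_) w → Bounded lo hi w → Bounded lo′ hi w
Bounded-raise lo′≤ b = All.zipWith (λ (lo′≤x , (_ , x<hi)) → lo′≤x , x<hi) (lo′≤ , b)

splitAt-Bounded : ∀ k {hi} w → Bounded k hi w → All (Bounded (suc k) hi) (splitAt k w)
splitAt-Bounded k []       []                  = [] ∷ []
splitAt-Bounded k (x ∷ xs) ((k≤x , x<hi) ∷ bs) with x ≡ᵇ k in x≡ᵇk
... | true  = [] ∷ splitAt-Bounded k xs bs
... | false = consHead-Bounded (splitAt-Bounded k xs bs)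
  where
  k<x : k < x
  k<x = ≤∧≢⇒< k≤x λ { refl → ≡true⇒≢false (≡ᵇ-refl k) x≡ᵇk }
  consHead-Bounded : ∀ {ps} → All (Bounded (suc k) _) ps → All (Bounded (suc k) _) (consHead x ps)
  consHead-Bounded []         = ((k<x , x<hi) ∷ []) ∷ []
  consHead-Bounded (bp ∷ bps) = ((k<x , x<hi) ∷ bp) ∷ bps

splitAt-above : ∀ k w → All (k <_) w → splitAt k w ≡ w ∷ []
splitAt-above k []       []          = refl
splitAt-above k (x ∷ xs) (k<x ∷ k<xs) rewrite >⇒≡ᵇ-false k<x | splitAt-above k xs k<xs = refl

leqAt : ℕ → ℕ → Word → Word → Bool
leqAt zero    k A B = true
leqAt (suc f) k A B = maxSubLeq (leqAt f (suc k)) (splitAt k A) (splitAt k B)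

leqAt-totalPreorder : ∀ f k → TotalPreorderᵇ (leqAt f k)
leqAt-totalPreorder zero    k = (λ _ _ → inj₁ refl) , λ _ _ → refl
leqAt-totalPreorder (suc f) k = TotalPreorderᵇ-on (splitAt k)
  (Lexicographic.maxSubLeq-totalPreorder (leqAt-totalPreorder f (suc k)))

leqAt-refl : ∀ f k A → leqAt f k A A ≡ true
leqAt-refl f k = Lexicographic.≼-refl (leqAt-totalPreorder f k)

leqAt-above : ∀ f k A B → All (k <_) A → All (k <_) B → leqAt (suc f) k A B ≡ leqAt f (suc k) A B
leqAt-above f k A B k<A k<B rewrite splitAt-above k A k<A | splitAt-above k B k<B =
  Lexicographic.maxSubLeq-[-] (leqAt-totalPreorder f (suc k)) A B

leqAt-stable : ∀ f f′ {k k′ h A B} → k ≤ k′ → h ≤ k + f → h ≤ k′ + f′ →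
               Bounded k′ h A → Bounded k′ h B → leqAt f k A B ≡ leqAt f′ k′ A B
leqAt-stable zero f′ {k} {k′} k≤k′ h≤k+0 _ bA bB
  with h≤k′ ← ≤-trans h≤k+0 (≤-trans (≤-reflexive (+-identityʳ k)) k≤k′)
  with refl ← Bounded-empty h≤k′ bA | refl ← Bounded-empty h≤k′ bB = sym (leqAt-refl f′ k′ [])
leqAt-stable (suc f) f′ {k} {k′} {h} {A} {B} k≤k′ h≤k+sf h≤k′+f′ bA bB with m≤n⇒m<n∨m≡n k≤k′
... | inj₁ k<k′ =
  trans (leqAt-above f k A B (All.map (λ (k′≤x , _) → <-≤-trans k<k′ k′≤x) bA)
                             (All.map (λ (k′≤x , _) → <-≤-trans k<k′ k′≤x) bB))
        (leqAt-stable f f′ k<k′ (≤-trans h≤k+sf (≤-reflexive (+-suc k f))) h≤k′+f′ bA bB)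
leqAt-stable (suc f) zero {k} _ _ h≤k+0 bA bB | inj₂ refl
  with h≤k ← ≤-trans h≤k+0 (≤-reflexive (+-identityʳ k))
  with refl ← Bounded-empty h≤k bA | refl ← Bounded-empty h≤k bB = leqAt-refl (suc f) k []
leqAt-stable (suc f) (suc f′) {k} {h = h} {A} {B} _ h≤k+sf h≤k+sf′ bA bB | inj₂ refl =
  Agreement.maxSubLeq-cong (Bounded (suc k) h)
    (λ sx sy → leqAt-stable f f′ ≤-refl (≤-trans h≤k+sf (≤-reflexive (+-suc k f)))
                                        (≤-trans h≤k+sf′ (≤-reflexive (+-suc k f′))) sx sy)
    (splitAt-Bounded k A bA) (splitAt-Bounded k B bB)

foldr-⊓-lowerBound : ∀ x xs → All (foldr _⊓_ x xs ≤_) (x ∷ xs)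
foldr-⊓-lowerBound x xs =
  foldr-preservesʳ {P = _≤ x} (λ y m≤x → ≤-trans (m⊓n≤n y _) m≤x) ≤-refl xs ∷
  foldr-forcesᵇ (λ y z b≤y⊓z → m≤n⊓o⇒m≤n y z b≤y⊓z , m≤n⊓o⇒m≤o y z b≤y⊓z) x xs ≤-refl

minSym-lowerBound : ∀ w → All (minSym w ≤_) w
minSym-lowerBound []       = []
minSym-lowerBound (x ∷ xs) = foldr-⊓-lowerBound x xs

maxSym-upperBound : ∀ w → All (_≤ maxSym w) w
maxSym-upperBound w =
  foldr-forcesᵇ (λ x y x⊔y≤b → m⊔n≤o⇒m≤o x y x⊔y≤b , m⊔n≤o⇒n≤o x y x⊔y≤b) 0 w ≤-refl

maxSym-lub : ∀ {b} w → All (_≤ b) w → maxSym w ≤ b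
maxSym-lub w = foldr-preservesᵇ ⊔-lub z≤n

leqF-leqAt : ∀ f {k h} A B → h ≤ k + f → Bounded k h A → Bounded k h B → leqF f A B ≡ leqAt f k A B
leqF-leqAt zero    A B _ _ _ = refl
leqF-leqAt (suc f) {k} A B h≤k+sf bA bB with A ++ B in A++B≡
... | [] with refl ← ++-conicalˡ A B A++B≡ | refl ← ++-conicalʳ A B A++B≡ = sym (leqAt-refl (suc f) k [])
... | x ∷ xs =
  trans (Agreement.maxSubLeq-cong (Bounded (suc n) _)
          (λ {a} {b} sa sb → leqF-leqAt f a b h≤sn+f sa sb)
          (splitAt-Bounded n A bA′) (splitAt-Bounded n B bB′))
        (sym (leqAt-stable (suc f) (suc f) k≤n h≤k+sf (≤-trans h≤k+sf (+-monoˡ-≤ (suc f) k≤n)) bA′ bB′))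
  where
  n = foldr _⊓_ x xs
  n≤A++B : All (n ≤_) (A ++ B)
  n≤A++B = subst (All (n ≤_)) (sym A++B≡) (foldr-⊓-lowerBound x xs)
  k≤n : k ≤ n
  k≤n with subst (All (k ≤_)) A++B≡ (++⁺ (All.map proj₁ bA) (All.map proj₁ bB))
  ... | k≤x ∷ k≤xs = foldr-preservesᵇ ⊓-glb k≤x k≤xs
  bA′ = Bounded-raise (++⁻ˡ A n≤A++B) bA
  bB′ = Bounded-raise (++⁻ʳ A n≤A++B) bB
  h≤sn+f = ≤-trans h≤k+sf (≤-trans (+-monoˡ-≤ (suc f) k≤n) (≤-reflexive (+-suc n f)))

leq-leqAt : ∀ {b} X Y → All (_≤ b) (X ++ Y) → leq X Y ≡ leqAt (suc b) 0 X Y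
leq-leqAt X Y ≤b =
  trans (leqF-leqAt (suc (mx ∸ mn)) X Y sucmx≤ (++⁻ˡ X bounds) (++⁻ʳ X bounds))
        (sym (leqAt-stable (suc _) (suc (mx ∸ mn)) z≤n (s≤s (maxSym-lub (X ++ Y) ≤b)) sucmx≤
               (++⁻ˡ X bounds) (++⁻ʳ X bounds)))
  where
  mn = minSym (X ++ Y)
  mx = maxSym (X ++ Y)
  bounds : Bounded mn (suc mx) (X ++ Y)
  bounds = All.zipWith (λ (lo , hi) → lo , s≤s hi) (minSym-lowerBound (X ++ Y) , maxSym-upperBound (X ++ Y))
  sucmx≤ : suc mx ≤ mn + suc (mx ∸ mn)
  sucmx≤ = ≤-trans (s≤s (m≤n+m∸n mx mn)) (≤-reflexive (sym (+-suc mn (mx ∸ mn))))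

leq-totalPreorder : TotalPreorderᵇ leq
leq-totalPreorder = total , λ {X} {Y} {Z} → trans′ {X} {Y} {Z}
  where
  total : ∀ X Y → X ≾ Y ⊎ Y ≾ X
  total X Y = Sum.map (trans (leq-leqAt X Y ub)) (trans (leq-leqAt Y X (++⁺ (++⁻ʳ X ub) (++⁻ˡ X ub))))
                      (proj₁ (leqAt-totalPreorder (suc (maxSym (X ++ Y))) 0) X Y)
    where ub = maxSym-upperBound (X ++ Y)
  trans′ : ∀ {X Y Z} → X ≾ Y → Y ≾ Z → X ≾ Z
  trans′ {X} {Y} {Z} X≾Y Y≾Z =
    trans (leq-leqAt X Z (++⁺ ubX ubZ))
      (proj₂ (leqAt-totalPreorder (suc b) 0) {X} {Y} {Z}
        (trans (sym (leq-leqAt X Y (++⁺ ubX ubY))) X≾Y)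
        (trans (sym (leq-leqAt Y Z (++⁺ ubY ubZ))) Y≾Z))
    where
    b = maxSym (X ++ Y ++ Z)
    ub = maxSym-upperBound (X ++ Y ++ Z)
    ubX = ++⁻ˡ X ub
    ubY = ++⁻ˡ Y (++⁻ʳ X ub)
    ubZ = ++⁻ʳ Y (++⁻ʳ X ub)

open Lexicographic leq-totalPreorder using (∷-≤ₗ-inv; ∷-≤ₗ-~; ∷-≤ₗ-<; ≤ₗ-trans; ∷-dominating-≰ₗ)
  renaming (≼-or-⋠ to ≾-or-⋠; ≼-refl to ≾-refl; ≼-trans to ≾-trans; ≼-flip to ≾-flip)

leastWitness : ∀ {P : ℕ → Set} → Decidable P → ∀ {N} → P N →
               Σ[ m ∈ ℕ ] P m × (∀ f → f < m → ¬ P f)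
leastWitness {P} P? {N} pN = search 0 N (λ _ ()) (subst P (sym (+-identityʳ N)) pN)
  where
  search : ∀ k d → (∀ f → f < k → ¬ P f) → P (d + k) → Σ[ m ∈ ℕ ] P m × (∀ f → f < m → ¬ P f)
  search k d below p with P? k
  search k d       below p  | yes pk = k , pk , below
  search k zero    below pk | no ¬pk = contradiction pk ¬pk
  search k (suc d) below p  | no ¬pk = search (suc k) d below′ (subst P (sym (+-suc d k)) p)
    where
    below′ : ∀ f → f < suc k → ¬ P f
    below′ f f<sk with m≤n⇒m<n∨m≡n (≤-pred f<sk)
    ... | inj₁ f<k  = below f f<k
    ... | inj₂ refl = ¬pk

module Greedy (n : ℕ) (A : ℕ → Word) where

  Above : ℕ → List ℕ → Set
  Above a us = Linked _<_ (a ∷ us) × All (_≤ n) us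

  MaximalAbove : ℕ → List ℕ → Set
  MaximalAbove a ts = Above a ts × (∀ us → Above a us → map A us ≤lex map A ts)

  UniquelyMaximalAbove : ℕ → List ℕ → Set
  UniquelyMaximalAbove a ts =
    MaximalAbove a ts × (∀ us → Above a us → map A ts ≤lex map A us → us ≡ ts)

  Above-lower : ∀ {a b us} → b ≤ a → Above a us → Above b us
  Above-lower {us = []}    _   (_ , bnd)          = [-] , bnd
  Above-lower {us = _ ∷ _} b≤a (a<u ∷ lk , bnd) = ≤-<-trans b≤a a<u ∷ lk , bnd

  Above⇒bounds : ∀ {a us} → Above a us → All (λ u → a < u × u ≤ n) us
  Above⇒bounds {us = []}    _                = []
  Above⇒bounds {us = _ ∷ _} (a<u ∷ lk , bnd) = All.zipWith id (Linked⇒All <-trans a<u lk , bnd)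

  IndexCollection⇒Above : ∀ {us} → IndexCollection n us → Above 0 us
  IndexCollection⇒Above {[]}    _                           = [-] , []
  IndexCollection⇒Above {_ ∷ _} (lk , bnd@((1≤u , _) ∷ _)) = 1≤u ∷ lk , All.map proj₂ bnd

  Above⇒IndexCollection : ∀ {us} → Above 0 us → IndexCollection n us
  Above⇒IndexCollection ab@(lk , _) = Linked.tail lk , Above⇒bounds ab

  least≤ : ∀ {a g u} → IsLeastGood n A a g → a < u → u ≤ n → A g ≾ A u → g ≤ u
  least≤ {g = g} {u} ((_ , _ , good) , least) a<u u≤n g≾u =
    least u (a<u , u≤n , λ l a<l l≤n → ≾-trans {A l} {A g} {A u} (good l a<l l≤n) g≾u)

  []-uniquelyMaximalAbove : UniquelyMaximalAbove n []
  []-uniquelyMaximalAbove =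
    (([-] , []) , λ us ab → subst (λ us → map A us ≤lex []) (sym (nothing-above-n ab)) refl) ,
    λ _ ab _ → nothing-above-n ab
    where
    nothing-above-n : ∀ {us} → Above n us → us ≡ []
    nothing-above-n {[]}    _                   = refl
    nothing-above-n {_ ∷ _} (n<u ∷ _ , u≤n ∷ _) = contradiction u≤n (<⇒≱ n<u)

  ∷-maximalAbove : ∀ {a g ts} → IsLeastGood n A a g → MaximalAbove g ts → MaximalAbove a (g ∷ ts)
  ∷-maximalAbove {a} {g} {ts} lg@((a<g , g≤n , good) , _) ((lk , bnd) , maximal) =
    (a<g ∷ lk , g≤n ∷ bnd) , maximal′
    where
    maximal′ : ∀ us → Above a us → map A us ≤lex map A (g ∷ ts)
    maximal′ []       _                         = refl
    maximal′ (u ∷ us) (a<u ∷ lk′ , u≤n ∷ bnd′) with ≾-or-⋠ (A g) (A u)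
    ... | inj₁ g≾u = ∷-≤ₗ-~ {A u} {A g} {map A us} {map A ts} (good u a<u u≤n) g≾u
                    (maximal us (Above-lower (least≤ lg a<u u≤n g≾u) (lk′ , bnd′)))
    ... | inj₂ g⋠u = ∷-≤ₗ-< {A u} {A g} {map A us} {map A ts} (good u a<u u≤n) g⋠u

  ∷-uniquelyMaximalAbove : ∀ {a g ts} → IsLeastGood n A a g →
                           UniquelyMaximalAbove g ts → UniquelyMaximalAbove a (g ∷ ts)
  ∷-uniquelyMaximalAbove {a} {g} {ts} lg@((_ , _ , good) , _) (max@(_ , maximal) , unique) =
    ∷-maximalAbove lg max , unique′
    where
    unique′ : ∀ us → Above a us → map A (g ∷ ts) ≤lex map A us → us ≡ g ∷ ts
    unique′ (u ∷ us) ab@(a<u ∷ lk , u≤n ∷ bnd) h with ∷-≤ₗ-inv {A g} {A u} {map A ts} {map A us} h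
    ... | inj₂ (_ , u⋠g) = ⊥-elim (≡true⇒≢false (good u a<u u≤n) u⋠g)
    ... | inj₁ (g≾u , _ , ts≤us) with m≤n⇒m<n∨m≡n (least≤ lg a<u u≤n g≾u)
    ...   | inj₂ refl = cong (g ∷_) (unique us (lk , bnd) ts≤us)
    ...   | inj₁ g<u  = ⊥-elim (∷-dominating-≰ₗ dominated
                          (≤ₗ-trans {map A (u ∷ us)} {map A ts}
                            (maximal (u ∷ us) (g<u ∷ lk , u≤n ∷ bnd)) ts≤us))
      where
      dominated : All (_≾ A u) (map A us)
      dominated = map⁺ (All.map (λ {v} (a<v , v≤n) → ≾-trans {A v} {A g} {A u} (good v a<v v≤n) g≾u)
                                (All.tail (Above⇒bounds ab)))

  greedy-uniquelyMaximalAbove : ∀ j (t : ℕ → ℕ) →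
    (∀ i → i < j → IsLeastGood n A (t i) (t (suc i))) → t j ≡ n →
    UniquelyMaximalAbove (t 0) (applyUpTo (t ∘ suc) j)
  greedy-uniquelyMaximalAbove zero    t _     t0≡n =
    subst (λ a → UniquelyMaximalAbove a []) (sym t0≡n) []-uniquelyMaximalAbove
  greedy-uniquelyMaximalAbove (suc j) t steps tj≡n =
    ∷-uniquelyMaximalAbove (steps 0 z<s)
      (greedy-uniquelyMaximalAbove j (t ∘ suc) (λ i i<j → steps (suc i) (s≤s i<j)) tj≡n)

  leastGood-from : ∀ d a → d + suc a ≡ n → Σ[ g ∈ ℕ ] IsLeastGood n A a g
  leastGood-from zero a refl = suc a , (≤-refl , ≤-refl , only) , λ _ (a<g , _) → a<g
    where
    only : ∀ l → a < l → l ≤ suc a → A l ≾ A (suc a)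
    only l a<l l≤sa = subst (λ l → A l ≾ A (suc a)) (≤-antisym a<l l≤sa) (≾-refl (A (suc a)))
  leastGood-from (suc d) a sd+sa≡n with leastGood-from d (suc a) (trans (+-suc d (suc a)) sd+sa≡n)
  ... | g , ((sa<g , g≤n , good) , least) with ≾-or-⋠ (A g) (A (suc a))
  ...   | inj₁ g≾sa = suc a , (≤-refl , ≤-trans (<⇒≤ sa<g) g≤n , good′) , λ _ (a<g′ , _) → a<g′
    where
    good′ : ∀ l → a < l → l ≤ n → A l ≾ A (suc a)
    good′ l a<l l≤n with m≤n⇒m<n∨m≡n a<l
    ... | inj₁ sa<l = ≾-trans {A l} {A g} {A (suc a)} (good l sa<l l≤n) g≾sa
    ... | inj₂ refl = ≾-refl (A (suc a))
  ...   | inj₂ g⋠sa = g , (<⇒≤ sa<g , g≤n , good′) , least′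
    where
    good′ : ∀ l → a < l → l ≤ n → A l ≾ A g
    good′ l a<l l≤n with m≤n⇒m<n∨m≡n a<l
    ... | inj₁ sa<l = good l sa<l l≤n
    ... | inj₂ refl = ≾-flip {A g} {A (suc a)} g⋠sa
    least′ : ∀ g′ → Good n A a g′ → g ≤ g′
    least′ g′ (a<g′ , g′≤n , good-g′) with m≤n⇒m<n∨m≡n a<g′
    ... | inj₁ sa<g′ = least g′ (sa<g′ , g′≤n , λ l sa<l → good-g′ l (<⇒≤ sa<l))
    ... | inj₂ refl  = ⊥-elim (≡true⇒≢false (good-g′ g (<⇒≤ sa<g) g≤n) g⋠sa)

  leastGood : ∀ {a} → a < n → Σ[ g ∈ ℕ ] IsLeastGood n A a g
  leastGood {a} a<n = leastGood-from (n ∸ suc a) a (m∸n+n≡m a<n)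

  next : ℕ → ℕ
  next a with a <? n
  ... | yes a<n = proj₁ (leastGood a<n)
  ... | no  _   = n

  next-leastGood : ∀ {a} → a < n → IsLeastGood n A a (next a)
  next-leastGood {a} a<n with a <? n
  ... | yes a<n′ = proj₂ (leastGood a<n′)
  ... | no  a≮n  = contradiction a<n a≮n

  next-≮ : ∀ {a} → ¬ a < n → next a ≡ n
  next-≮ {a} a≮n with a <? n
  ... | yes a<n = contradiction a<n a≮n
  ... | no  _   = refl

  next-≤ : ∀ a → next a ≤ n
  next-≤ a with a <? n
  ... | yes a<n = proj₁ (proj₂ (proj₁ (proj₂ (leastGood a<n))))
  ... | no  _   = ≤-refl

  seq : ℕ → ℕ
  seq zero    = 0
  seq (suc k) = next (seq k)

  seq-≤ : ∀ k → seq k ≤ n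
  seq-≤ zero    = z≤n
  seq-≤ (suc k) = next-≤ (seq k)

  seq-spec : SeqSpec n A seq
  seq-spec = refl , λ k →
    (λ sk≢n → next-leastGood (≤∧≢⇒< (seq-≤ k) sk≢n)) , λ sk≡n → next-≮ (<-irrefl sk≡n)

  seq-reaches : ∀ k → seq k ≡ n ⊎ k ≤ seq k
  seq-reaches zero    = inj₂ z≤n
  seq-reaches (suc k) with m≤n⇒m<n∨m≡n (seq-≤ k) | seq-reaches k
  ... | inj₂ sk≡n | _         = inj₁ (next-≮ (<-irrefl sk≡n))
  ... | inj₁ sk<n | inj₁ sk≡n = contradiction sk≡n (<⇒≢ sk<n)
  ... | inj₁ sk<n | inj₂ k≤sk = inj₂ (≤-<-trans k≤sk (proj₁ (proj₁ (next-leastGood sk<n))))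

  seq-n : seq n ≡ n
  seq-n with seq-reaches n
  ... | inj₁ sn≡n = sn≡n
  ... | inj₂ n≤sn = ≤-antisym (seq-≤ n) n≤sn

  hitTime : Σ[ m ∈ ℕ ] seq m ≡ n × (∀ f → f < m → seq f ≢ n)
  hitTime = leastWitness (λ f → seq f ≟ n) {n} seq-n

  m : ℕ
  m = proj₁ hitTime

  seq-m : seq m ≡ n
  seq-m = proj₁ (proj₂ hitTime)

  seq-<m : ∀ f → f < m → seq f ≢ n
  seq-<m = proj₂ (proj₂ hitTime)

  firstTerms-uniquelyMaximalAbove : UniquelyMaximalAbove 0 (firstTerms seq m)
  firstTerms-uniquelyMaximalAbove =
    subst (UniquelyMaximalAbove 0) (sym (map-upTo (seq ∘ suc) m))
      (greedy-uniquelyMaximalAbove m seq (λ i i<m → proj₁ (proj₂ seq-spec i) (seq-<m i i<m)) seq-m)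

  uniquelyMaximalAbove⇒uniqueMaximal : ∀ {ts} → UniquelyMaximalAbove 0 ts →
    IsMaximal n A ts × (∀ ts′ → IsMaximal n A ts′ → ts′ ≡ ts)
  uniquelyMaximalAbove⇒uniqueMaximal {ts} ((above , maximal) , unique) =
    (Above⇒IndexCollection above , λ us ic → maximal us (IndexCollection⇒Above ic)) ,
    λ ts′ (ic , maximal′) →
      unique ts′ (IndexCollection⇒Above ic) (maximal′ ts (Above⇒IndexCollection above))

lemma1 : (n : ℕ) → 1 ≤ n → (A : ℕ → Word) →
    Σ[ s ∈ (ℕ → ℕ) ] Σ[ m ∈ ℕ ]
    SeqSpec n A s × IsMinHit n s m ×
    IsMaximal n A (firstTerms s m) ×
    (∀ ts → IsMaximal n A ts → ts ≡ firstTerms s m)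
lemma1 n 1≤n A =
  seq , m , seq-spec , minHit , uniquelyMaximalAbove⇒uniqueMaximal firstTerms-uniquelyMaximalAbove
  where
  open Greedy n A
  minHit : IsMinHit n seq m
  minHit = ≤∧≢⇒< z≤n (λ 0≡m → <⇒≢ 1≤n (trans (cong seq 0≡m) seq-m)) , seq-m , λ f _ → seq-<m f
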